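{- Let $G$ be a finite abelian group of order $n\ge 2$. If there exists an $(n,2;k_1,k_2;\ell)$-RWEDF in $G$, then $\ell\ge\sqrt{2/(n-1)}$.
   Context: $G$ is written additively, $G^*=G\setminus\{0\}$. For pairwise disjoint nonempty subsets $A_1,\dots,A_m$ of $G$ and $\delta\in G^*$, let $N_i(\delta)=|\{(a_i,a_j): a_i\in A_i,\ a_j\in A_j \text{ for some } j\neq i,\ a_i-a_j=\delta\}|$. An $(n,m;k_1,\dots,k_m;\ell)$-RWEDF is a collection of pairwise disjoint subsets with $|A_i|=k_i$ such that $\sum_i \frac{1}{k_i}N_i(\delta)=\ell$ for all $\delta\in G^*$. -}

module Defs where

open import Level using (Level)
open import Algebra.Bundles using (AbelianGroup)
open import Data.Nat as ℕ using (ℕ; zero; suc)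
open import Data.Fin as Fin using (Fin)
open import Data.Fin.Subset using (Subset; ∣_∣)
open import Data.Bool using (Bool; true; false; _∧_; not; if_then_else_)
open import Data.Vec using (lookup)
open import Data.Product using (Σ; ∃; _×_; _,_)
open import Data.Integer using (+_)
open import Data.Rational as ℚ using (ℚ; 0ℚ; _+_; _/_)
open import Relation.Binary.PropositionalEquality using (_≡_; refl)
open import Relation.Binary using (Decidable)
open import Relation.Nullary using (¬_; yes; no; Dec)
open import Relation.Nullary.Decidable using (⌊_⌋)

-- A finite abelian group of order n: an abelian group (written with _∙_,
-- read additively) together with an enumeration Fin n → Carrier that is a
-- bijection up to the group's equality _≈_.
record FiniteAbelianGroup (c ℓ : Level) (n : ℕ) : Set (Level.suc (c Level.⊔ ℓ)) where
  field
    abGroup : AbelianGroup c ℓ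
  open AbelianGroup abGroup public
  field
    enum       : Fin n → Carrier
    enum-inj   : ∀ i j → enum i ≈ enum j → i ≡ j
    enum-surj  : ∀ g → ∃ λ i → enum i ≈ g

  _≈?_ : Decidable _≈_
  g ≈? h with enum-surj g | enum-surj h
  ... | i , p | j , q with i Fin.≟ j
  ... | yes refl = yes (trans (sym p) q)
  ... | no i≢j = no λ g≈h → i≢j (enum-inj i j (trans p (trans g≈h (sym q))))

sumFin : ∀ {n} → (Fin n → ℕ) → ℕ
sumFin {zero}  f = 0
sumFin {suc n} f = f Fin.zero ℕ.+ sumFin (λ i → f (Fin.suc i))

count : ∀ {n} → (Fin n → Bool) → ℕ
count P = sumFin (λ i → if P i then 1 else 0)

anyFin : ∀ {m} → (Fin m → Bool) → Bool
anyFin {zero}  P = false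
anyFin {suc m} P = P Fin.zero Data.Bool.∨ anyFin (λ i → P (Fin.suc i))

-- (1/k) * N as a rational; k is always ≥ 1 for the sets considered
-- (they are nonempty), so the zero branch is never used.
fracℚ : ℕ → ℕ → ℚ
fracℚ N zero    = 0ℚ
fracℚ N (suc k) = (+ N) / suc k

sumℚ : ∀ {m} → (Fin m → ℚ) → ℚ
sumℚ {zero}  f = 0ℚ
sumℚ {suc m} f = f Fin.zero + sumℚ (λ i → f (Fin.suc i))

module _ {c ℓ n} (G : FiniteAbelianGroup c ℓ n) where
  open FiniteAbelianGroup G

  -- subsets of G are given as subsets of the index set Fin n via enum
  _∈ˢ_ : Fin n → Subset n → Bool
  x ∈ˢ A = lookup A x

  N : ∀ {m} → (Fin m → Subset n) → Fin m → Carrier → ℕ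
  N A i δ = sumFin λ x → count λ y →
      (x ∈ˢ A i)
    ∧ anyFin (λ j → not ⌊ i Fin.≟ j ⌋ ∧ (y ∈ˢ A j))
    ∧ ⌊ (enum x - enum y) ≈? δ ⌋

  record IsRWEDF (m : ℕ) (k : Fin m → ℕ) (l : ℚ) (A : Fin m → Subset n) : Set (c Level.⊔ ℓ) where
    field
      disjoint : ∀ i j → ¬ i ≡ j → ∀ x → (x ∈ˢ A i) ∧ (x ∈ˢ A j) ≡ false
      nonempty : ∀ i → ∃ λ x → (x ∈ˢ A i) ≡ true
      size     : ∀ i → ∣ A i ∣ ≡ k i
      balance  : ∀ δ → ¬ δ ≈ ε → sumℚ (λ i → fracℚ (N A i δ) (k i)) ≡ l

module Submission where

-- Write M = n − 1, K₁ = |A₁|, K₂ = |A₂| and, for a nonzero δ, let a(δ), b(δ)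
-- count the representations of δ as a difference from A₁ − A₂ and A₂ − A₁.
-- Balance says a(δ)/K₁ + b(δ)/K₂ = l for every δ ≠ 0.  Since A₁, A₂ are
-- disjoint, 0 is never such a difference, so Σ_{δ≠0} a(δ) = Σ_{δ≠0} b(δ) = K₁K₂.
-- Summing the balance condition gives l M = K₁ + K₂ > 0; hence every nonzero δ
-- is represented, so M ≤ Σ (a + b) = 2 K₁ K₂, and by AM-GM
--   2M ≤ 4 K₁ K₂ ≤ (K₁ + K₂)² = l² M²,   i.e.  2 ≤ l² M.

open import Defs
open import Data.Nat using (suc)

module FiniteSums where
  open import Data.Nat using (ℕ; zero; _+_; _*_; _≤_; z≤n)
  open import Data.Nat.Properties using (+-*-semiring; +-mono-≤; +-identityʳ)
  open import Data.Fin using (Fin; zero; suc; punchIn)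
  open import Data.Fin.Properties using (punchInᵢ≢i)
  open import Data.Fin.Subset using (Subset; ∣_∣)
  open import Data.Vec using (_∷_; []; lookup)
  open import Data.Bool using (Bool; true; false; if_then_else_; _∧_)
  open import Relation.Binary.PropositionalEquality
  open import Algebra.Properties.Semiring.Sum +-*-semiring public
    using (sum; sum-cong-≗; sum-remove; ∑-distrib-+; ∑-comm; *-distribˡ-sum; *-distribʳ-sum)
  open import Algebra.Properties.Semiring.Sum +-*-semiring
    using (sum-replicate-zero)

  ind : Bool → ℕ
  ind b = if b then 1 else 0

  ind-∧ : ∀ a b → ind (a ∧ b) ≡ ind a * ind b
  ind-∧ true  b = sym (+-identityʳ (ind b))
  ind-∧ false b = refl

  sumFin≡sum : ∀ {m} (f : Fin m → ℕ) → sumFin f ≡ sum f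
  sumFin≡sum {zero}  f = refl
  sumFin≡sum {suc m} f = cong (f zero +_) (sumFin≡sum (λ i → f (suc i)))

  sumFin-count : ∀ {m} (P : Fin m → Fin m → Bool) →
                 sumFin (λ x → count (P x)) ≡ sum (λ x → sum (λ y → ind (P x y)))
  sumFin-count P = trans (sumFin≡sum (λ x → count (P x)))
                         (sum-cong-≗ (λ x → sumFin≡sum (λ y → ind (P x y))))

  card≡sum : ∀ {n} (X : Subset n) → ∣ X ∣ ≡ sum (λ x → ind (lookup X x))
  card≡sum []          = refl
  card≡sum (true  ∷ X) = cong suc (card≡sum X)
  card≡sum (false ∷ X) = card≡sum X

  sum-zero : ∀ {m} (f : Fin m → ℕ) → (∀ i → f i ≡ 0) → sum f ≡ 0
  sum-zero {m} f f≡0 = trans (sum-cong-≗ f≡0) (sum-replicate-zero m)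

  sum-const : ∀ {m} c → sum {m} (λ _ → c) ≡ m * c
  sum-const {zero}  c = refl
  sum-const {suc m} c = cong (c +_) (sum-const {m} c)

  sum-single : ∀ {m} (f : Fin m → ℕ) i → (∀ j → j ≢ i → f j ≡ 0) → sum f ≡ f i
  sum-single {suc m} f i off-i = begin
    sum f                              ≡⟨ sum-remove {i = i} f ⟩
    f i + sum (λ j → f (punchIn i j))  ≡⟨ cong (f i +_) (sum-zero _ (λ j → off-i _ (punchInᵢ≢i i j))) ⟩
    f i + 0                            ≡⟨ +-identityʳ (f i) ⟩
    f i                                ∎
    where open ≡-Reasoning

  sum-lower : ∀ {m} (f : Fin m → ℕ) → (∀ i → 1 ≤ f i) → m ≤ sum f
  sum-lower {zero}  f f≥1 = z≤n
  sum-lower {suc m} f f≥1 = +-mono-≤ (f≥1 zero) (sum-lower (λ i → f (suc i)) (λ i → f≥1 (suc i)))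

module CountingBound where
  open FiniteSums
  open import Data.Nat using (ℕ; zero; _+_; _*_; _≤_; _<_; z≤n; s≤s; NonZero; >-nonZero; ≢-nonZero⁻¹)
  open import Data.Nat.Properties
  open import Data.Nat.Tactic.RingSolver using (solve-∀)
  open import Data.Fin using (Fin)
  open import Data.Product using (_,_)
  open import Data.Sum using (inj₁; inj₂)
  open import Relation.Nullary using (contradiction)
  open import Relation.Binary.PropositionalEquality

  -- (x + (x + t))² = 4x(x + t) + t², so 4xy ≤ (x + y)² whenever x ≤ y.
  am-gm-ordered : ∀ {x y} → x ≤ y → 4 * (x * y) ≤ (x + y) * (x + y)
  am-gm-ordered {x} x≤y with m≤n⇒∃[o]m+o≡n x≤y
  ... | t , refl = subst (4 * (x * (x + t)) ≤_) (square-split x t) (m≤m+n _ (t * t))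
    where
    square-split : ∀ x t → 4 * (x * (x + t)) + t * t ≡ (x + (x + t)) * (x + (x + t))
    square-split = solve-∀

  am-gm : ∀ x y → 4 * (x * y) ≤ (x + y) * (x + y)
  am-gm x y with ≤-total x y
  ... | inj₁ x≤y = am-gm-ordered x≤y
  ... | inj₂ y≤x = subst₂ _≤_ (cong (4 *_) (*-comm y x)) (cong₂ _*_ (+-comm y x) (+-comm y x))
                     (am-gm-ordered y≤x)

  -- The counting core of the theorem.  a i and b i count the representations
  -- of the i-th nonzero difference from A₁ − A₂ and from A₂ − A₁ (M nonzero
  -- differences in all), with |A₁| = K₁ = suc k₁, |A₂| = K₂ = suc k₂, and the
  -- weighted balance condition a i/K₁ + b i/K₂ = P/D cleared of denominators.
  module _ {M : ℕ} (a b : Fin M → ℕ) (k₁ k₂ P d : ℕ) where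
    private
      K₁ K₂ K S D : ℕ
      K₁ = suc k₁
      K₂ = suc k₂
      K  = K₁ * K₂
      S  = K₁ + K₂
      D  = suc d

    module _ (sum-a : sum a ≡ K) (sum-b : sum b ≡ K)
             (balanced : ∀ i → (a i * K₂ + b i * K₁) * D ≡ P * K) where

      weighted-sum : sum (λ i → a i * K₂ + b i * K₁) ≡ K * S
      weighted-sum = begin
        sum (λ i → a i * K₂ + b i * K₁)      ≡⟨ ∑-distrib-+ (λ i → a i * K₂) (λ i → b i * K₁) ⟩
        sum (λ i → a i * K₂) + sum (λ i → b i * K₁)
                                             ≡⟨ cong₂ _+_ (*-distribʳ-sum K₂ a) (*-distribʳ-sum K₁ b) ⟨
        sum a * K₂ + sum b * K₁              ≡⟨ cong₂ (λ u v → u * K₂ + v * K₁) sum-a sum-b ⟩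
        K * K₂ + K * K₁                      ≡⟨ *-distribˡ-+ K K₂ K₁ ⟨
        K * (K₂ + K₁)                        ≡⟨ cong (K *_) (+-comm K₂ K₁) ⟩
        K * S                                ∎
        where open ≡-Reasoning

      -- Summing the balance condition over all M nonzero differences: S D = M P,
      -- i.e. the common value l = P/D equals (K₁ + K₂)/M.
      S*D≡M*P : S * D ≡ M * P
      S*D≡M*P = *-cancelˡ-≡ (S * D) (M * P) K (begin
        K * (S * D)                          ≡⟨ *-assoc K S D ⟨
        K * S * D                            ≡⟨ cong (_* D) weighted-sum ⟨
        sum (λ i → a i * K₂ + b i * K₁) * D  ≡⟨ *-distribʳ-sum D (λ i → a i * K₂ + b i * K₁) ⟩
        sum (λ i → (a i * K₂ + b i * K₁) * D) ≡⟨ sum-cong-≗ balanced ⟩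
        sum {M} (λ _ → P * K)                ≡⟨ sum-const {M} (P * K) ⟩
        M * (P * K)                          ≡⟨ reorder M P K ⟩
        K * (M * P)                          ∎)
        where
        open ≡-Reasoning
        reorder : ∀ m p k → m * (p * k) ≡ k * (m * p)
        reorder = solve-∀

      instance
        M*P≢0 : NonZero (M * P)
        M*P≢0 = >-nonZero (subst (0 <_) S*D≡M*P (s≤s z≤n))

        M≢0 : NonZero M
        M≢0 = m*n≢0⇒m≢0 M

        P≢0 : NonZero P
        P≢0 = m*n≢0⇒n≢0 M

      -- Since P > 0 (l > 0), every nonzero difference is represented at least once.
      represented : ∀ i → 1 ≤ a i + b i
      represented i with a i | b i | balanced i
      ... | suc _ | _     | _    = s≤s z≤n
      ... | zero  | suc _ | _    = s≤s z≤n
      ... | zero  | zero  | 0≡PK = contradiction (sym 0≡PK) (≢-nonZero⁻¹ (P * K) {{m*n≢0 P K}})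

      2M≤S² : 2 * M ≤ S * S
      2M≤S² = begin
        2 * M                    ≤⟨ *-monoʳ-≤ 2 (sum-lower (λ i → a i + b i) represented) ⟩
        2 * sum (λ i → a i + b i) ≡⟨ cong (2 *_) (trans (∑-distrib-+ a b) (cong₂ _+_ sum-a sum-b)) ⟩
        2 * (K + K)              ≡⟨ double K ⟩
        4 * K                    ≤⟨ am-gm K₁ K₂ ⟩
        S * S                    ∎
        where
        open ≤-Reasoning
        double : ∀ k → 2 * (k + k) ≡ 4 * k
        double = solve-∀

      counting-bound : 2 * (D * D) ≤ P * P * M
      counting-bound = *-cancelˡ-≤ M (begin
        M * (2 * (D * D))        ≡⟨ regroupˡ M D ⟩
        (2 * M) * (D * D)        ≤⟨ *-monoˡ-≤ (D * D) 2M≤S² ⟩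
        (S * S) * (D * D)        ≡⟨ regroupʳ S D ⟩
        (S * D) * (S * D)        ≡⟨ cong₂ _*_ S*D≡M*P S*D≡M*P ⟩
        (M * P) * (M * P)        ≡⟨ regroup M P ⟩
        M * (P * P * M)          ∎)
        where
        open ≤-Reasoning
        regroupˡ : ∀ m d → m * (2 * (d * d)) ≡ (2 * m) * (d * d)
        regroupˡ = solve-∀
        regroupʳ : ∀ s d → (s * s) * (d * d) ≡ (s * d) * (s * d)
        regroupʳ = solve-∀
        regroup : ∀ m p → (m * p) * (m * p) ≡ m * (p * p * m)
        regroup = solve-∀

module DifferenceCounts {c ℓ n} (G : FiniteAbelianGroup c ℓ n) where
  open FiniteSums
  open import Data.Nat using (ℕ; _*_)
  open import Data.Fin as Fin using (Fin)
  open import Data.Fin.Subset using (Subset; ∣_∣)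
  open import Data.Vec using (lookup)
  open import Data.Bool using (Bool; true; false; _∧_; not)
  open import Data.Bool.Properties using (∧-assoc; ∧-identityʳ; ∧-zeroʳ)
  open import Data.Product using (proj₁; proj₂)
  open import Relation.Nullary.Decidable using (⌊_⌋; isYes≗does; dec-true; dec-false)
  open import Relation.Nullary using (yes; no)
  open import Relation.Binary.PropositionalEquality
  open import Algebra.Properties.Group using (x∙y⁻¹≈ε⇒x≈y)
  open FiniteAbelianGroup G hiding (refl) renaming (sym to ≈-sym; trans to ≈-trans)

  diffCount : Subset n → Subset n → Carrier → ℕ
  diffCount X Y δ = sum λ x → sum λ y →
    ind (lookup X x ∧ (lookup Y y ∧ ⌊ (enum x - enum y) ≈? δ ⌋))

  inOther : ∀ {m} → (Fin m → Subset n) → Fin m → Fin n → Bool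
  inOther A i y = anyFin (λ j → not ⌊ i Fin.≟ j ⌋ ∧ lookup (A j) y)

  N≡sum : ∀ {m} (A : Fin m → Subset n) i δ →
          N G A i δ ≡ sum λ x → sum λ y →
                        ind (lookup (A i) x ∧ (inOther A i y ∧ ⌊ (enum x - enum y) ≈? δ ⌋))
  N≡sum A i δ = sumFin-count (λ x y → lookup (A i) x ∧ (inOther A i y ∧ ⌊ (enum x - enum y) ≈? δ ⌋))

  N≡diffCount : ∀ {m} (A : Fin m → Subset n) i Y → (∀ y → inOther A i y ≡ lookup Y y) →
                ∀ δ → N G A i δ ≡ diffCount (A i) Y δ
  N≡diffCount A i Y others δ = trans (N≡sum A i δ) (sum-cong-≗ λ x → sum-cong-≗ λ y →
    cong (λ b → ind (lookup (A i) x ∧ (b ∧ ⌊ (enum x - enum y) ≈? δ ⌋))) (others y))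

  unique-index : ∀ g (b : Bool) → sum (λ d → ind (b ∧ ⌊ g ≈? enum d ⌋)) ≡ ind b
  unique-index g false = sum-zero {n} _ (λ _ → refl)
  unique-index g true  = trans (sum-single _ i₀ off-i₀)
    (cong ind (trans (isYes≗does (g ≈? enum i₀)) (dec-true (g ≈? enum i₀) (≈-sym i₀-is-g))))
    where
    i₀ = proj₁ (enum-surj g)
    i₀-is-g = proj₂ (enum-surj g)
    off-i₀ : ∀ d → d ≢ i₀ → ind ⌊ g ≈? enum d ⌋ ≡ 0
    off-i₀ d d≢i₀ = cong ind (trans (isYes≗does (g ≈? enum d)) (dec-false (g ≈? enum d) λ g≈d →
      d≢i₀ (enum-inj d i₀ (≈-trans (≈-sym g≈d) (≈-sym i₀-is-g)))))

  -- Every pair (x, y) ∈ X × Y has exactly one difference, so the difference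
  -- counts of X − Y add up to |X| |Y|.
  diffCount-total : ∀ X Y → sum (λ d → diffCount X Y (enum d)) ≡ ∣ X ∣ * ∣ Y ∣
  diffCount-total X Y = begin
    sum (λ d → sum λ x → sum λ y → F x y d)   ≡⟨ ∑-comm (λ d x → sum λ y → F x y d) ⟩
    sum (λ x → sum λ d → sum λ y → F x y d)   ≡⟨ sum-cong-≗ (λ x → ∑-comm (λ d y → F x y d)) ⟩
    sum (λ x → sum λ y → sum λ d → F x y d)   ≡⟨ sum-cong-≗ (λ x → sum-cong-≗ (one-difference x)) ⟩
    sum (λ x → sum λ y → χX x * χY y)         ≡⟨ sum-cong-≗ (λ x → *-distribˡ-sum (χX x) χY) ⟨
    sum (λ x → χX x * sum χY)                 ≡⟨ *-distribʳ-sum (sum χY) χX ⟨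
    sum χX * sum χY                           ≡⟨ cong₂ _*_ (card≡sum X) (card≡sum Y) ⟨
    ∣ X ∣ * ∣ Y ∣                             ∎
    where
    open ≡-Reasoning
    χX χY : Fin n → ℕ
    χX x = ind (lookup X x)
    χY y = ind (lookup Y y)
    x-y≈ : Fin n → Fin n → Fin n → Bool
    x-y≈ x y d = ⌊ (enum x - enum y) ≈? enum d ⌋
    F : Fin n → Fin n → Fin n → ℕ
    F x y d = ind (lookup X x ∧ (lookup Y y ∧ x-y≈ x y d))
    one-difference : ∀ x y → sum (λ d → F x y d) ≡ χX x * χY y
    one-difference x y = begin
      sum (λ d → F x y d)
        ≡⟨ sum-cong-≗ (λ d → cong ind (∧-assoc (lookup X x) (lookup Y y) (x-y≈ x y d))) ⟨
      sum (λ d → ind ((lookup X x ∧ lookup Y y) ∧ x-y≈ x y d))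
        ≡⟨ unique-index (enum x - enum y) (lookup X x ∧ lookup Y y) ⟩
      ind (lookup X x ∧ lookup Y y)
        ≡⟨ ind-∧ (lookup X x) (lookup Y y) ⟩
      χX x * χY y ∎

  diffCount-zero : ∀ X Y → (∀ x → lookup X x ∧ lookup Y x ≡ false) →
                   ∀ δ → δ ≈ ε → diffCount X Y δ ≡ 0
  diffCount-zero X Y disjoint δ δ≈ε = sum-zero {n} _ λ x → sum-zero {n} _ λ y → cong ind (no-pair x y)
    where
    no-pair : ∀ x y → lookup X x ∧ (lookup Y y ∧ ⌊ (enum x - enum y) ≈? δ ⌋) ≡ false
    no-pair x y with (enum x - enum y) ≈? δ
    ... | no _ = trans (cong (lookup X x ∧_) (∧-zeroʳ (lookup Y y))) (∧-zeroʳ (lookup X x))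
    ... | yes x-y≈δ with enum-inj x y (x∙y⁻¹≈ε⇒x≈y group (enum x) (enum y) (≈-trans x-y≈δ δ≈ε))
    ...   | refl = trans (cong (lookup X x ∧_) (∧-identityʳ (lookup Y x))) (disjoint x)

module ClearingDenominators where
  import Data.Nat as ℕ
  import Data.Nat.Properties as ℕ
  open import Data.Integer as ℤ using (+_; -[1+_]; +≤+)
  import Data.Integer.Properties as ℤ
  open import Data.Rational using (mkℚ; 0ℚ; _+_; _*_; _≤_; _/_; ↥_; ↧_; ↧ₙ_; toℚᵘ)
  open import Data.Rational.Properties
    using (toℚᵘ-cong; toℚᵘ-homo-+; toℚᵘ-homo-*; toℚᵘ-fromℚᵘ; toℚᵘ-cancel-≤; nonNegative⁻¹)
  open import Data.Rational.Unnormalised as ℚᵘ using (mkℚᵘ; _≃_; *≡*; *≤*)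
  import Data.Rational.Unnormalised.Properties as ℚᵘ
  open import Data.Product using (_×_; _,_)
  open import Relation.Binary.PropositionalEquality

  -- The balance equation a/K₁ + b/K₂ = l (a sum over Fin 2 in Defs), read in
  -- the unnormalised rationals where addition does not reduce fractions.
  unnormalised-balance : ∀ l a b k₁ k₂ → (+ a / suc k₁) + ((+ b / suc k₂) + 0ℚ) ≡ l →
                         mkℚᵘ (+ a) k₁ ℚᵘ.+ mkℚᵘ (+ b) k₂ ≃ toℚᵘ l
  unnormalised-balance l a b k₁ k₂ balance = ℚᵘ.≃-trans (ℚᵘ.≃-sym as-ℚᵘ) (toℚᵘ-cong balance)
    where
    b/K₂ : toℚᵘ ((+ b / suc k₂) + 0ℚ) ≃ mkℚᵘ (+ b) k₂
    b/K₂ = ℚᵘ.≃-trans (toℚᵘ-homo-+ (+ b / suc k₂) 0ℚ)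
             (ℚᵘ.≃-trans (ℚᵘ.+-congˡ (toℚᵘ 0ℚ) (toℚᵘ-fromℚᵘ (mkℚᵘ (+ b) k₂)))
                         (ℚᵘ.+-identityʳ (mkℚᵘ (+ b) k₂)))
    as-ℚᵘ : toℚᵘ ((+ a / suc k₁) + ((+ b / suc k₂) + 0ℚ)) ≃ mkℚᵘ (+ a) k₁ ℚᵘ.+ mkℚᵘ (+ b) k₂
    as-ℚᵘ = ℚᵘ.≃-trans (toℚᵘ-homo-+ (+ a / suc k₁) _)
              (ℚᵘ.+-cong (toℚᵘ-fromℚᵘ (mkℚᵘ (+ a) k₁)) b/K₂)

  -- Clearing denominators: with l = ↥l/↧l, a K₂ + b K₁ times ↧l equals ↥l K₁ K₂.
  -- As the left side is a natural number, ↥l is nonnegative.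
  cleared-balance : ∀ l a b k₁ k₂ → (+ a / suc k₁) + ((+ b / suc k₂) + 0ℚ) ≡ l →
    ↥ l ≡ + ℤ.∣ ↥ l ∣ × (a ℕ.* suc k₂ ℕ.+ b ℕ.* suc k₁) ℕ.* ↧ₙ l ≡ ℤ.∣ ↥ l ∣ ℕ.* (suc k₁ ℕ.* suc k₂)
  cleared-balance l@record{} a b k₁ k₂ balance
    with unnormalised-balance l a b k₁ k₂ balance
  ... | *≡* cross-multiplied = natural-numerator (↥ l) (trans (sym integral-lhs) cross-multiplied)
    where
    E = a ℕ.* suc k₂ ℕ.+ b ℕ.* suc k₁
    integral-lhs : (+ a ℤ.* + suc k₂ ℤ.+ + b ℤ.* + suc k₁) ℤ.* ↧ l ≡ + (E ℕ.* ↧ₙ l)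
    integral-lhs = begin
      (+ a ℤ.* + suc k₂ ℤ.+ + b ℤ.* + suc k₁) ℤ.* ↧ l
        ≡⟨ cong₂ (λ u v → (u ℤ.+ v) ℤ.* ↧ l) (ℤ.pos-* a (suc k₂)) (ℤ.pos-* b (suc k₁)) ⟨
      (+ (a ℕ.* suc k₂) ℤ.+ + (b ℕ.* suc k₁)) ℤ.* ↧ l
        ≡⟨ cong (ℤ._* ↧ l) (ℤ.pos-+ (a ℕ.* suc k₂) (b ℕ.* suc k₁)) ⟨
      + E ℤ.* ↧ l
        ≡⟨ ℤ.pos-* E (↧ₙ l) ⟨
      + (E ℕ.* ↧ₙ l) ∎
      where open ≡-Reasoning
    natural-numerator : ∀ z → + (E ℕ.* ↧ₙ l) ≡ z ℤ.* + (suc k₁ ℕ.* suc k₂) →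
                        z ≡ + ℤ.∣ z ∣ × E ℕ.* ↧ₙ l ≡ ℤ.∣ z ∣ ℕ.* (suc k₁ ℕ.* suc k₂)
    natural-numerator (+ P)     eq = refl , ℤ.+-injective (trans eq (sym (ℤ.pos-* P _)))
    natural-numerator -[1+ p ] ()

  nonnegative : ∀ l → ↥ l ≡ + ℤ.∣ ↥ l ∣ → 0ℚ ≤ l
  nonnegative l@(mkℚ (+ _) _ _) _ = nonNegative⁻¹ l

  squared-bound : ∀ l M → ↥ l ≡ + ℤ.∣ ↥ l ∣ →
    2 ℕ.* (↧ₙ l ℕ.* ↧ₙ l) ℕ.≤ ℤ.∣ ↥ l ∣ ℕ.* ℤ.∣ ↥ l ∣ ℕ.* M → (+ 2) / 1 ≤ l * l * ((+ M) / 1)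
  squared-bound l@(mkℚ (+ P) d-1 _) M _ 2D²≤P²M =
    toℚᵘ-cancel-≤ (ℚᵘ.≤-respʳ-≃ (ℚᵘ.≃-sym l²M≃q) (*≤* 2D²≤P²M-in-ℤ))
    where
    D = suc d-1
    q = toℚᵘ l ℚᵘ.* toℚᵘ l ℚᵘ.* mkℚᵘ (+ M) 0
    l²M≃q : toℚᵘ (l * l * ((+ M) / 1)) ≃ q
    l²M≃q = ℚᵘ.≃-trans (toℚᵘ-homo-* (l * l) ((+ M) / 1))
              (ℚᵘ.*-cong (toℚᵘ-homo-* l l) (toℚᵘ-fromℚᵘ (mkℚᵘ (+ M) 0)))
    2D²≤P²M-in-ℤ : + 2 ℤ.* + (D ℕ.* D ℕ.* 1) ℤ.≤ (+ P ℤ.* + P ℤ.* + M) ℤ.* + 1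
    2D²≤P²M-in-ℤ = subst₂ ℤ._≤_ (ℤ.pos-* 2 (D ℕ.* D ℕ.* 1)) P²M-in-ℤ
      (+≤+ (subst₂ ℕ._≤_ (cong (2 ℕ.*_) (sym (ℕ.*-identityʳ (D ℕ.* D))))
                           (sym (ℕ.*-identityʳ (P ℕ.* P ℕ.* M))) 2D²≤P²M))
      where
      P²M-in-ℤ : + (P ℕ.* P ℕ.* M ℕ.* 1) ≡ (+ P ℤ.* + P ℤ.* + M) ℤ.* + 1
      P²M-in-ℤ = trans (ℤ.pos-* (P ℕ.* P ℕ.* M) 1)
        (cong (ℤ._* + 1) (trans (ℤ.pos-* (P ℕ.* P) M) (cong (ℤ._* + M) (ℤ.pos-* P P))))

module SubsetSize where
  open import Data.Nat using (_≤_)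
  open import Data.Fin.Subset using (Subset; ∣_∣; ⁅_⁆; _⊆_; _∈_)
  open import Data.Vec using (lookup)
  open import Data.Fin.Subset.Properties using (∣⁅x⁆∣≡1; p⊆q⇒∣p∣≤∣q∣; x∈⁅y⁆⇒x≡y)
  open import Data.Vec.Properties using (lookup⇒[]=)
  open import Data.Bool using (true)
  open import Data.Product using (proj₂)
  open import Relation.Binary.PropositionalEquality

  member⇒size≥1 : ∀ {n} (X : Subset n) x → lookup X x ≡ true → 1 ≤ ∣ X ∣
  member⇒size≥1 X x x∈X = subst (_≤ ∣ X ∣) (∣⁅x⁆∣≡1 x) (p⊆q⇒∣p∣≤∣q∣ ⁅x⁆⊆X)
    where
    ⁅x⁆⊆X : ⁅ x ⁆ ⊆ X
    ⁅x⁆⊆X y∈⁅x⁆ = subst (_∈ X) (sym (x∈⁅y⁆⇒x≡y x y∈⁅x⁆)) (lookup⇒[]= x X x∈X)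

  size-positive : ∀ {c ℓ n m} {G : FiniteAbelianGroup c ℓ n} {k l A} →
                  IsRWEDF G m k l A → ∀ i → 1 ≤ k i
  size-positive {A = A} R i = subst (1 ≤_) (size i) (member⇒size≥1 (A i) _ (proj₂ (nonempty i)))
    where open IsRWEDF R

module TwoSets {c ℓ m} (G : FiniteAbelianGroup c ℓ (suc (suc m))) where
  open FiniteSums
  open CountingBound
  open ClearingDenominators
  open import Data.Nat as ℕ using (ℕ)
  open import Data.Nat.Properties using (*-comm)
  open import Data.Fin using (Fin; zero; suc; punchIn)
  open import Data.Fin.Properties using (punchInᵢ≢i)
  open import Data.Fin.Subset using (Subset; ∣_∣)
  open import Data.Vec using (_∷_; []; lookup)
  open import Data.Bool using (_∧_; false)
  open import Data.Integer as ℤ using (+_)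
  open import Data.Rational as ℚ using (ℚ; 0ℚ; _≤_; _*_; _/_; _+_; ↥_; ↧ₙ_)
  open import Data.Product using (_×_; _,_; proj₁; proj₂)
  open import Data.Bool.Properties using (∨-identityʳ)
  open import Relation.Nullary using (¬_)
  open import Relation.Binary.PropositionalEquality
  open FiniteAbelianGroup G hiding (refl) renaming (sym to ≈-sym; trans to ≈-trans)
  open DifferenceCounts G

  -- The index of the identity; the nonzero elements are enumerated by
  -- skipping it, giving M = n − 1 = suc m nonzero differences.
  zero-index : Fin (suc (suc m))
  zero-index = proj₁ (enum-surj ε)

  nonzero : Fin (suc m) → Carrier
  nonzero i = enum (punchIn zero-index i)

  nonzero≉ε : ∀ i → ¬ nonzero i ≈ ε
  nonzero≉ε i δ≈ε = punchInᵢ≢i zero-index i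
    (enum-inj _ _ (≈-trans δ≈ε (≈-sym (proj₂ (enum-surj ε)))))

  -- Disjoint sets have no zero difference, so the nonzero differences of
  -- X − Y still account for all |X| |Y| pairs.
  nonzero-total : ∀ X Y → (∀ x → lookup X x ∧ lookup Y x ≡ false) →
                  sum (λ i → diffCount X Y (nonzero i)) ≡ ∣ X ∣ ℕ.* ∣ Y ∣
  nonzero-total X Y disjoint = begin
    rest                                      ≡⟨ cong (ℕ._+ rest) at-zero ⟨
    diffCount X Y (enum zero-index) ℕ.+ rest  ≡⟨ sum-remove {i = zero-index} (λ d → diffCount X Y (enum d)) ⟨
    sum (λ d → diffCount X Y (enum d))        ≡⟨ diffCount-total X Y ⟩
    ∣ X ∣ ℕ.* ∣ Y ∣                           ∎
    where
    open ≡-Reasoning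
    rest : ℕ
    rest = sum (λ i → diffCount X Y (nonzero i))
    at-zero : diffCount X Y (enum zero-index) ≡ 0
    at-zero = diffCount-zero X Y disjoint _ (proj₂ (enum-surj ε))

  two-set-bound : ∀ k₁ k₂ l (A : Fin 2 → Subset (suc (suc m))) →
                  IsRWEDF G 2 (lookup (suc k₁ ∷ suc k₂ ∷ [])) l A →
                  (0ℚ ≤ l) × ((+ 2) / 1 ≤ l * l * ((+ suc m) / 1))
  two-set-bound k₁ k₂ l A R =
    nonnegative l numerator-natural ,
    squared-bound l (suc m) numerator-natural
      (counting-bound a b k₁ k₂ P (ℚ.denominator-1 l) sum-a sum-b (λ i → proj₂ (cleared i)))
    where
    open IsRWEDF R
    A₁ = A zero
    A₂ = A (suc zero)
    P = ℤ.∣ ↥ l ∣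
    a b : Fin (suc m) → ℕ
    a i = diffCount A₁ A₂ (nonzero i)
    b i = diffCount A₂ A₁ (nonzero i)
    sum-a : sum a ≡ suc k₁ ℕ.* suc k₂
    sum-a = trans (nonzero-total A₁ A₂ (disjoint zero (suc zero) (λ ())))
                  (cong₂ ℕ._*_ (size zero) (size (suc zero)))
    sum-b : sum b ≡ suc k₁ ℕ.* suc k₂
    sum-b = trans (nonzero-total A₂ A₁ (disjoint (suc zero) zero (λ ())))
                  (trans (cong₂ ℕ._*_ (size (suc zero)) (size zero)) (*-comm (suc k₂) (suc k₁)))
    balance-at : ∀ i → (+ a i / suc k₁) + ((+ b i / suc k₂) + 0ℚ) ≡ l
    balance-at i = subst₂ (λ u v → (+ u / suc k₁) + ((+ v / suc k₂) + 0ℚ) ≡ l)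
      (N≡diffCount A zero A₂ (λ y → ∨-identityʳ (lookup A₂ y)) (nonzero i))
      (N≡diffCount A (suc zero) A₁ (λ y → ∨-identityʳ (lookup A₁ y)) (nonzero i))
      (balance (nonzero i) (nonzero≉ε i))
    cleared : ∀ i → ↥ l ≡ + P × (a i ℕ.* suc k₂ ℕ.+ b i ℕ.* suc k₁) ℕ.* ↧ₙ l ≡ P ℕ.* (suc k₁ ℕ.* suc k₂)
    cleared i = cleared-balance l (a i) (b i) k₁ k₂ (balance-at i)
    numerator-natural : ↥ l ≡ + P
    numerator-natural = proj₁ (cleared zero)

open import Data.Nat as ℕ using (ℕ; _∸_)
open import Data.Fin as Fin using (Fin)
open import Data.Fin.Subset using (Subset)
open import Data.Vec using (_∷_; []; lookup)
open import Data.Product using (∃; _×_; _,_)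
open import Data.Integer using (+_)
open import Data.Rational using (ℚ; 0ℚ; _≤_; _*_; _/_)

open SubsetSize using (size-positive)
open TwoSets using (two-set-bound)

mainTheorem7 : ∀ {c ℓ} (n : ℕ) → 2 ℕ.≤ n → (G : FiniteAbelianGroup c ℓ n)
    → (k₁ k₂ : ℕ) (l : ℚ)
    → (∃ λ (A : Fin 2 → Subset n) → IsRWEDF G 2 (lookup (k₁ ∷ k₂ ∷ [])) l A)
    → (0ℚ ≤ l) × ((+ 2) / 1 ≤ l * l * ((+ (n ∸ 1)) / 1))
mainTheorem7 (suc (suc m)) (ℕ.s≤s (ℕ.s≤s ℕ.z≤n)) G k₁ k₂ l (A , R)
  with size-positive R Fin.zero | size-positive R (Fin.suc Fin.zero)
... | ℕ.s≤s ℕ.z≤n | ℕ.s≤s ℕ.z≤n = two-set-bound G _ _ l A R
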